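{- Let $k\ge1$, $\pi\in S_k$, $i\in[k]$, and let $p=(\pi,R)$ with $R=[k]\times([k]\setminus\{i\})$ (all rows of boxes shaded except row $i$, which is fully unshaded). Then for every $n\ge k$, \[ s_n^+(p)=\frac{n!}{k!}\qquad\text{and}\qquad \frac{s_n^+(p)}{n!}=\frac1{k!}. \]
   Context: For $n\ge1$, $S_n$ is the set of permutations of $\{1,\dots,n\}$ in one-line notation $\tau=\tau_1\cdots\tau_n$. For an integer $k\ge0$ write $[k]=\{0,1,\dots,k\}$. A mesh pattern of length $k$ is a pair $(\pi,R)$ with $\pi\in S_k$ and $R\subseteq[k]\times[k]$; the elements $(x,y)\in R$ are the shaded boxes (box $(x,y)$ is the unit square with south-west corner $(x,y)$ in the plot of the points $(i,\pi_i)$); row $y$ of boxes is $[k]\times\{y\}$ and column $x$ is $\{x\}\times[k]$. An occurrence of $(\pi,R)$ in $\tau\in S_n$ is a choice of positions $i_1<\dots<i_k$ such that $\tau_{i_a}<\tau_{i_b}$ iff $\pi_a<\pi_b$ for all $a,b$, and such that for every $(x,y)\in R$ there is no index $m$ with $i_x<m<i_{x+1}$ and $v_y<\tau_m<v_{y+1}$, where $i_0=0$, $i_{k+1}=n+1$, $v_0=0$, $v_{k+1}=n+1$, and for $1\le y\le k$, $v_y$ is the $y$-th smallest of the values $\tau_{i_1},\dots,\tau_{i_k}$. A permutation contains a mesh pattern if it has at least one occurrence of it, and $s_n^+(p)$ denotes the number of permutations in $S_n$ containing $p$. -}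

module Defs where

open import Data.Nat using (ℕ; zero; suc; _+_; _*_; _∸_; _≤_; _<_; _!)
open import Data.Nat.Properties using (≤-decTotalOrder; _!≢0)
open import Data.Nat as ℕ using ()
open import Data.List using (List; []; _∷_; length)
open import Data.Vec using (Vec; toList)
open import Data.Fin using (Fin)
open import Data.Product using (Σ; _×_; ∃-syntax)
open import Data.List.Relation.Unary.All using (All)
open import Data.List.Relation.Unary.Unique.Propositional using (Unique)
open import Data.List.Membership.Propositional using (_∈_)
open import Function.Bundles using (_⇔_)
open import Relation.Nullary using (¬_)
open import Relation.Binary.PropositionalEquality using (_≡_; _≢_)
open import Data.List.Sort ≤-decTotalOrder using (sort)

-- Permutations are written in one-line notation as vectors of naturals.
-- 1-based lookup with default value d (used only outside the range 1..length).
nth : ℕ → List ℕ → ℕ → ℕ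
nth d []       _             = d
nth d (x ∷ xs) zero          = d
nth d (x ∷ xs) (suc zero)    = x
nth d (x ∷ xs) (suc (suc m)) = nth d xs (suc m)

IsPerm : (n : ℕ) → Vec ℕ n → Set
IsPerm n τ = Unique (toList τ) × All (λ v → 1 ≤ v × v ≤ n) (toList τ)

val : {n : ℕ} → Vec ℕ n → ℕ → ℕ
val τ m = nth 0 (toList τ) m

-- An occurrence of the mesh pattern (π , R) of length k in τ ∈ S_n,
-- given by the positions ι = (i_1,…,i_k) (as a vector, 1-based).
-- R is a predicate on boxes (x , y) (meaningful for x , y ∈ [k]).
module _ {k n : ℕ} (π : Vec ℕ k) (R : ℕ → ℕ → Set) (τ : Vec ℕ n) (ι : Vec ℕ k) where

  -- i_x for x ∈ {0,…,k+1}, with i_0 = 0 and i_{k+1} = n+1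
  pos : ℕ → ℕ
  pos zero    = 0
  pos (suc x) = nth (suc n) (toList ι) (suc x)

  occVals : List ℕ
  occVals = Data.List.map (val τ) (toList ι)

  -- v_y for y ∈ {0,…,k+1}: v_0 = 0, v_y = y-th smallest occurrence value, v_{k+1} = n+1
  vv : ℕ → ℕ
  vv zero    = 0
  vv (suc y) = nth (suc n) (sort occVals) (suc y)

  IsOccurrence : Set
  IsOccurrence =
      ((a : ℕ) → 1 ≤ a → a ≤ k → 1 ≤ pos a × pos a ≤ n)
    × ((a b : ℕ) → 1 ≤ a → a < b → b ≤ k → pos a < pos b)
    × ((a b : ℕ) → 1 ≤ a → a ≤ k → 1 ≤ b → b ≤ k →
         (val τ (pos a) < val τ (pos b)) ⇔ (nth 0 (toList π) a < nth 0 (toList π) b))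
    × ((x y : ℕ) → x ≤ k → y ≤ k → R x y →
         ¬ (∃[ m ] (pos x < m × m < pos (suc x) × vv y < val τ m × val τ m < vv (suc y))))

Contains : {k n : ℕ} → Vec ℕ k → (ℕ → ℕ → Set) → Vec ℕ n → Set
Contains {k} π R τ = ∃[ ι ] IsOccurrence π R τ ι

-- "the number of τ ∈ S_n containing (π , R) equals c":
-- there is a duplicate-free list of exactly these permutations, of length c.
NumContaining : {k : ℕ} (n : ℕ) → Vec ℕ k → (ℕ → ℕ → Set) → ℕ → Set
NumContaining n π R c =
  Σ (List (Vec ℕ n)) λ L →
    Unique L × ((τ : Vec ℕ n) → (τ ∈ L) ⇔ (IsPerm n τ × Contains π R τ)) × length L ≡ c

allRowsBut : (k i : ℕ) → ℕ → ℕ → Set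
allRowsBut k i x y = x ≤ k × y ≤ k × y ≢ i

_!/_! : ℕ → ℕ → ℕ
n !/ k ! = (n ! ℕ./ k !) {{k !≢0}}

-- Write d = n − k and call the values i+1, …, i+d inner, the others outer. Every entry
-- off an occurrence lies in an unshaded box, hence in row i, so these d entries have values
-- strictly between v_i ≥ i and v_{i+1} ≤ i + d + 1. This forces v_i = i and v_{i+1} = i+d+1:
-- the occurrence consists exactly of the outer entries, which therefore read spread ∘ π for
-- the increasing bijection spread from {1, …, k} onto the outer values; conversely the outer
-- entries of such a τ form an occurrence. These τ arise from spread ∘ π by inserting
-- i+1, …, i+d one at a time into any of the k+1, …, n available gaps, so there are n!/k!.

module Submission where

open import Defs
open import Level using (0ℓ)
open import Function using (_∘_; id)
open import Function.Bundles using (_⇔_; mk⇔; Equivalence)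
open import Data.Empty using (⊥-elim)
open import Data.Product using (Σ; _×_; _,_; proj₁; proj₂; ∃-syntax)
open import Data.Sum using (_⊎_; inj₁; inj₂; [_,_]′; map₂)
open import Data.Nat using (ℕ; zero; suc; _+_; _*_; _∸_; _≤_; _<_; _≟_; _≤?_; _<?_; z≤n; s≤s; _!)
open import Data.Nat.Properties
open import Data.Nat.DivMod using (_/_; m*n/n≡m)
open import Algebra.Properties.CommutativeSemigroup *-commutativeSemigroup using (xy∙z≈y∙xz)
open import Data.Fin as Fin using (Fin)
open import Data.Vec as Vec using (Vec; toList; []; _∷_; insertAt; cast; fromList)
import Data.Vec.Properties as Vecₚ
open import Data.List using (List; []; _∷_; _++_; length; map; filter; cartesianProductWith; zip; allFin)
import Data.List.Properties as Listₚ
open import Data.List.Relation.Unary.All as All using (All; []; _∷_)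
open import Data.List.Relation.Unary.Any as Any using (here; there; any?)
open import Data.List.Relation.Unary.AllPairs as AllPairs using (AllPairs; []; _∷_)
import Data.List.Relation.Unary.AllPairs.Properties as AllPairs
open import Data.List.Relation.Unary.Unique.Propositional using (Unique)
import Data.List.Relation.Unary.Unique.Propositional.Properties as Unique
open import Data.List.Relation.Unary.Linked.Properties using (Linked⇒AllPairs)
open import Data.List.Relation.Binary.Subset.Propositional using (_⊆_)
open import Data.List.Membership.Propositional using (_∈_; _∉_)
open import Data.List.Membership.Propositional.Properties
  using (∈-filter⁺; ∈-filter⁻; ∈-map⁺; ∈-map⁻; ∈-cartesianProductWith⁺; ∈-cartesianProductWith⁻; ∈-allFin)
open import Data.List.Relation.Binary.Permutation.Propositional using (↭-sym; ↭⇒↭ₛ)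
open import Data.List.Relation.Binary.Permutation.Propositional.Properties using (∈-resp-↭; ↭-length)
import Data.List.Relation.Binary.Permutation.Setoid.Properties as Permutationₛ
open import Data.List.Sort ≤-decTotalOrder using (sort; sort-↭; sort-↗)
open import Relation.Nullary using (¬_; yes; no; ¬?)
open import Relation.Nullary.Decidable using (_⊎-dec_; _×-dec_; toSum)
open import Relation.Unary using (Pred; Decidable)
open import Relation.Binary.Definitions using (DecidableEquality; tri<; tri≈; tri>)
open import Relation.Binary.PropositionalEquality
  using (_≡_; _≢_; refl; sym; trans; cong; cong₂; subst; subst₂; setoid; module ≡-Reasoning)

module _ {A : Set} (_≟ᴬ_ : DecidableEquality A) where

  private
    without : A → List A → List A
    without x = filter (λ y → ¬? (y ≟ᴬ x))

    length-without< : ∀ {x ys} → x ∈ ys → length (without x ys) < length ys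
    length-without< x∈ys = Listₚ.filter-notAll (λ y → ¬? (y ≟ᴬ _)) _ (Any.map (λ x≡y y≢x → y≢x (sym x≡y)) x∈ys)

  mutual
    Unique-⊆⇒length≤ : ∀ {xs ys} → Unique xs → xs ⊆ ys → length xs ≤ length ys
    Unique-⊆⇒length≤ {[]} _ _ = z≤n
    Unique-⊆⇒length≤ {x ∷ xs} (x∉xs ∷ u) xs⊆ys =
      Unique-⊆⇒length< u (xs⊆ys ∘ there) (xs⊆ys (here refl)) (λ x∈xs → All.lookup x∉xs x∈xs refl)

    Unique-⊆⇒length< : ∀ {xs ys c} → Unique xs → xs ⊆ ys → c ∈ ys → c ∉ xs → length xs < length ys
    Unique-⊆⇒length< {xs} {ys} {c} u xs⊆ys c∈ys c∉xs =
      ≤-trans (s≤s (Unique-⊆⇒length≤ u xs⊆without)) (length-without< c∈ys)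
      where
      xs⊆without : xs ⊆ without c ys
      xs⊆without z∈xs = ∈-filter⁺ (λ y → ¬? (y ≟ᴬ c)) (xs⊆ys z∈xs) λ { refl → c∉xs z∈xs }

  Unique-⊆⊇⇒length≡ : ∀ {xs ys} → Unique xs → Unique ys → xs ⊆ ys → ys ⊆ xs → length xs ≡ length ys
  Unique-⊆⊇⇒length≡ ux uy xs⊆ys ys⊆xs = ≤-antisym (Unique-⊆⇒length≤ ux xs⊆ys) (Unique-⊆⇒length≤ uy ys⊆xs)

  Unique-⊆-length≥⇒⊇ : ∀ {xs ys} → Unique xs → xs ⊆ ys → length ys ≤ length xs → ys ⊆ xs
  Unique-⊆-length≥⇒⊇ {xs} u xs⊆ys ys≤xs {c} c∈ys with any? (c ≟ᴬ_) xs
  ... | yes c∈xs = c∈xs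
  ... | no c∉xs = ⊥-elim (<⇒≱ (Unique-⊆⇒length< u xs⊆ys c∈ys c∉xs) ys≤xs)

module _ {A : Set} {P Q : Pred A 0ℓ} (P? : Decidable P) (Q? : Decidable Q) where

  length-filter-complementary : (∀ x → P x ⊎ Q x) → (∀ {x} → P x → ¬ Q x) →
    ∀ xs → length (filter P? xs) + length (filter Q? xs) ≡ length xs
  length-filter-complementary P⊎Q P⇒¬Q [] = refl
  length-filter-complementary P⊎Q P⇒¬Q (x ∷ xs) with P? x | Q? x
  ... | yes p | yes q = ⊥-elim (P⇒¬Q p q)
  ... | yes _ | no _ = cong suc (length-filter-complementary P⊎Q P⇒¬Q xs)
  ... | no _ | yes _ = trans (+-suc _ _) (cong suc (length-filter-complementary P⊎Q P⇒¬Q xs))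
  ... | no ¬p | no ¬q = [ ⊥-elim ∘ ¬p , ⊥-elim ∘ ¬q ]′ (P⊎Q x)

  length-filter-congOn : ∀ xs → (∀ {x} → x ∈ xs → P x → Q x) → (∀ {x} → x ∈ xs → Q x → P x) →
    length (filter P? xs) ≡ length (filter Q? xs)
  length-filter-congOn [] _ _ = refl
  length-filter-congOn (x ∷ xs) P⇒Q Q⇒P with P? x | Q? x
  ... | yes _ | yes _ = cong suc (length-filter-congOn xs (P⇒Q ∘ there) (Q⇒P ∘ there))
  ... | yes p | no ¬q = ⊥-elim (¬q (P⇒Q (here refl) p))
  ... | no ¬p | yes q = ⊥-elim (¬p (Q⇒P (here refl) q))
  ... | no _ | no _ = length-filter-congOn xs (P⇒Q ∘ there) (Q⇒P ∘ there)

length-filter-map : {A B : Set} {P : Pred B 0ℓ} (P? : Decidable P) (g : A → B) →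
  ∀ xs → length (filter P? (map g xs)) ≡ length (filter (P? ∘ g) xs)
length-filter-map P? g [] = refl
length-filter-map P? g (x ∷ xs) with P? (g x)
... | yes _ = cong suc (length-filter-map P? g xs)
... | no _ = length-filter-map P? g xs

Unique-map⁺-injectiveOn : {A B : Set} (g : A → B) → ∀ {xs} → Unique xs →
  (∀ {a b} → a ∈ xs → b ∈ xs → g a ≡ g b → a ≡ b) → Unique (map g xs)
Unique-map⁺-injectiveOn g [] _ = []
Unique-map⁺-injectiveOn g {x ∷ xs} (x∉xs ∷ u) inj =
  All.tabulate (λ y∈gxs gx≡y → let (y , y∈xs , e) = ∈-map⁻ g y∈gxs in
                  All.lookup x∉xs y∈xs (inj (here refl) (there y∈xs) (trans gx≡y e)))
  ∷ Unique-map⁺-injectiveOn g u (λ a∈ b∈ → inj (there a∈) (there b∈))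

length-cartesianProductWith : {A B C : Set} (g : A → B → C) → ∀ xs ys →
  length (cartesianProductWith g xs ys) ≡ length xs * length ys
length-cartesianProductWith g [] ys = refl
length-cartesianProductWith g (x ∷ xs) ys = begin
  length (map (g x) ys ++ cartesianProductWith g xs ys)     ≡⟨ Listₚ.length-++ (map (g x) ys) ⟩
  length (map (g x) ys) + length (cartesianProductWith g xs ys)
    ≡⟨ cong₂ _+_ (Listₚ.length-map (g x) ys) (length-cartesianProductWith g xs ys) ⟩
  length ys + length xs * length ys                           ∎
  where open ≡-Reasoning

Unique-cartesianProductWith-injectiveOn : {A B C : Set} (g : A → B → C) → ∀ {xs ys} →
  Unique xs → Unique ys →
  (∀ {a a' b b'} → a ∈ xs → a' ∈ xs → g a b ≡ g a' b' → a ≡ a' × b ≡ b') →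
  Unique (cartesianProductWith g xs ys)
Unique-cartesianProductWith-injectiveOn g {[]} _ _ _ = []
Unique-cartesianProductWith-injectiveOn g {x ∷ xs} {ys} (x∉xs ∷ ux) uy inj =
  Unique.++⁺ (Unique-map⁺-injectiveOn (g x) uy (λ _ _ e → proj₂ (inj (here refl) (here refl) e)))
             (Unique-cartesianProductWith-injectiveOn g ux uy (λ a∈ a'∈ → inj (there a∈) (there a'∈)))
             disjoint
  where
  disjoint : ∀ {v} → ¬ (v ∈ map (g x) ys × v ∈ cartesianProductWith g xs ys)
  disjoint (v∈head , v∈tail) with ∈-map⁻ (g x) v∈head | ∈-cartesianProductWith⁻ g xs ys v∈tail
  ... | _ , _ , e | a' , _ , a'∈xs , _ , e' =
    All.lookup x∉xs a'∈xs (proj₁ (inj (here refl) (there a'∈xs) (trans (sym e) e')))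

nth-∈ : ∀ d xs m → m < length xs → nth d xs (suc m) ∈ xs
nth-∈ d (x ∷ xs) zero _ = here refl
nth-∈ d (x ∷ xs) (suc m) (s≤s m<) = there (nth-∈ d xs m m<)

∈⇒nth : ∀ d {x} xs → x ∈ xs → ∃[ m ] (m < length xs × nth d xs (suc m) ≡ x)
∈⇒nth d (y ∷ xs) (here refl) = zero , s≤s z≤n , refl
∈⇒nth d (y ∷ xs) (there x∈xs) with ∈⇒nth d xs x∈xs
... | m , m< , e = suc m , s≤s m< , e

nth-≥length : ∀ d xs m → length xs ≤ m → nth d xs (suc m) ≡ d
nth-≥length d [] m _ = refl
nth-≥length d (x ∷ xs) (suc m) (s≤s ≤m) = nth-≥length d xs m ≤m

nth-map : ∀ d d' (g : ℕ → ℕ) xs m → m < length xs →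
  nth d' (map g xs) (suc m) ≡ g (nth d xs (suc m))
nth-map d d' g (x ∷ xs) zero _ = refl
nth-map d d' g (x ∷ xs) (suc m) (s≤s m<) = nth-map d d' g xs m m<

nth-injective : ∀ d {xs} → Unique xs → ∀ {a b} → a < length xs → b < length xs →
  nth d xs (suc a) ≡ nth d xs (suc b) → a ≡ b
nth-injective d {x ∷ xs} u {zero} {zero} _ _ _ = refl
nth-injective d {x ∷ xs} (x∉ ∷ u) {zero} {suc b} _ (s≤s b<) e = ⊥-elim (All.lookup x∉ (nth-∈ d xs b b<) e)
nth-injective d {x ∷ xs} (x∉ ∷ u) {suc a} {zero} (s≤s a<) _ e = ⊥-elim (All.lookup x∉ (nth-∈ d xs a a<) (sym e))
nth-injective d {x ∷ xs} (x∉ ∷ u) {suc a} {suc b} (s≤s a<) (s≤s b<) e = cong suc (nth-injective d u a< b< e)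

Increasing : List ℕ → Set
Increasing = AllPairs _<_

Increasing⇒Unique : ∀ {xs} → Increasing xs → Unique xs
Increasing⇒Unique = AllPairs.map <⇒≢

nth-<-mono : ∀ d {xs} → Increasing xs → ∀ {a b} → a < b → b < length xs →
  nth d xs (suc a) < nth d xs (suc b)
nth-<-mono d {x ∷ xs} (x< ∷ _) {zero} {suc b} _ (s≤s b<) = All.lookup x< (nth-∈ d xs b b<)
nth-<-mono d {x ∷ xs} (_ ∷ inc) {suc a} {suc b} (s≤s a<b) (s≤s b<) = nth-<-mono d inc a<b b<

nth-≤-mono : ∀ d {xs} → Increasing xs → ∀ {a b} → a ≤ b → b < length xs →
  nth d xs (suc a) ≤ nth d xs (suc b)
nth-≤-mono d inc a≤b b< with m≤n⇒m<n∨m≡n a≤b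
... | inj₁ a<b = <⇒≤ (nth-<-mono d inc a<b b<)
... | inj₂ refl = ≤-refl

nth-<-mono⇒Increasing : ∀ d xs →
  (∀ {a b} → a < b → b < length xs → nth d xs (suc a) < nth d xs (suc b)) → Increasing xs
nth-<-mono⇒Increasing d [] _ = []
nth-<-mono⇒Increasing d (x ∷ xs) mono =
  All.tabulate (λ y∈xs → let (m , m< , e) = ∈⇒nth d xs y∈xs in
                 subst (x <_) e (mono (s≤s z≤n) (s≤s m<)))
  ∷ nth-<-mono⇒Increasing d xs (λ a<b b< → mono (s≤s a<b) (s≤s b<))

Increasing-⊆⊇⇒≡ : ∀ {xs ys} → Increasing xs → Increasing ys → xs ⊆ ys → ys ⊆ xs → xs ≡ ys
Increasing-⊆⊇⇒≡ {[]} {[]} _ _ _ _ = refl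
Increasing-⊆⊇⇒≡ {[]} {y ∷ ys} _ _ _ ys⊆xs with ys⊆xs (here refl)
... | ()
Increasing-⊆⊇⇒≡ {x ∷ xs} {[]} _ _ xs⊆ys _ with xs⊆ys (here refl)
... | ()
Increasing-⊆⊇⇒≡ {x ∷ xs} {y ∷ ys} (x< ∷ incx) (y< ∷ incy) xs⊆ys ys⊆xs =
  cong₂ _∷_ x≡y (Increasing-⊆⊇⇒≡ incx incy (tail x< y< xs⊆ys x≡y) (tail y< x< ys⊆xs (sym x≡y)))
  where
  x≡y : x ≡ y
  x≡y with xs⊆ys (here refl) | ys⊆xs (here refl)
  ... | here e | _ = e
  ... | there _ | here e = sym e
  ... | there x∈ys | there y∈xs = ⊥-elim (<-asym (All.lookup y< x∈ys) (All.lookup x< y∈xs))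
  tail : ∀ {u v us vs} → All (u <_) us → All (v <_) vs → (u ∷ us) ⊆ (v ∷ vs) → u ≡ v → us ⊆ vs
  tail u< v< ⊆ refl z∈us with ⊆ (there z∈us)
  ... | here refl = ⊥-elim (<-irrefl refl (All.lookup u< z∈us))
  ... | there z∈vs = z∈vs

nth-lowerBound : ∀ d lo {zs} → Increasing zs → All (lo <_) zs →
  ∀ m → m < length zs → lo + suc m ≤ nth d zs (suc m)
nth-lowerBound d lo {z ∷ zs} _ (lo<z ∷ _) zero _ = subst (_≤ z) (+-comm 1 lo) lo<z
nth-lowerBound d lo {z ∷ zs} (z< ∷ inc) (lo<z ∷ _) (suc m) (s≤s m<) = begin
  lo + suc (suc m)  ≡⟨ +-suc lo (suc m) ⟩
  suc lo + suc m    ≤⟨ +-monoˡ-≤ (suc m) lo<z ⟩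
  z + suc m         ≤⟨ nth-lowerBound d z inc z< m m< ⟩
  nth d zs (suc m)  ∎
  where open ≤-Reasoning

private
  head-upperBound : ∀ hi z {zs} → z ≤ hi → All (z <_) zs → Increasing zs → All (_≤ hi) zs →
    z + length zs ≤ hi
  head-upperBound hi z {[]} z≤hi _ _ _ = subst (_≤ hi) (sym (+-identityʳ z)) z≤hi
  head-upperBound hi z {w ∷ ws} z≤hi (z<w ∷ _) (w< ∷ inc) (w≤hi ∷ ≤hi) = begin
    z + suc (length ws)  ≡⟨ +-suc z (length ws) ⟩
    suc z + length ws    ≤⟨ +-monoˡ-≤ (length ws) z<w ⟩
    w + length ws        ≤⟨ head-upperBound hi w w≤hi w< inc ≤hi ⟩
    hi                   ∎
    where open ≤-Reasoning

nth-upperBound : ∀ d hi {zs} → Increasing zs → All (_≤ hi) zs →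
  ∀ m → m < length zs → nth d zs (suc m) + (length zs ∸ suc m) ≤ hi
nth-upperBound d hi {z ∷ zs} (z< ∷ inc) (z≤hi ∷ ≤hi) zero _ = head-upperBound hi z z≤hi z< inc ≤hi
nth-upperBound d hi {z ∷ zs} (_ ∷ inc) (_ ∷ ≤hi) (suc m) (s≤s m<) = nth-upperBound d hi inc ≤hi m m<

sort-Increasing : ∀ {xs} → Unique xs → Increasing (sort xs)
sort-Increasing {xs} u = AllPairs.zipWith (λ (x≤y , x≢y) → ≤∧≢⇒< x≤y x≢y)
  (Linked⇒AllPairs ≤-trans (sort-↗ xs) ,
   Permutationₛ.Unique-resp-↭ (setoid ℕ) (↭⇒↭ₛ (↭-sym (sort-↭ xs))) u)

∈-sort⁻ : ∀ xs → sort xs ⊆ xs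
∈-sort⁻ xs = ∈-resp-↭ (sort-↭ xs)

∈-sort⁺ : ∀ xs → xs ⊆ sort xs
∈-sort⁺ xs = ∈-resp-↭ (↭-sym (sort-↭ xs))

length-sort : ∀ xs → length (sort xs) ≡ length xs
length-sort xs = ↭-length (sort-↭ xs)

interval : ℕ → ℕ → List ℕ
interval lo zero = []
interval lo (suc c) = suc lo ∷ interval (suc lo) c

length-interval : ∀ lo c → length (interval lo c) ≡ c
length-interval lo zero = refl
length-interval lo (suc c) = cong suc (length-interval (suc lo) c)

∈-interval⁻ : ∀ {v} lo c → v ∈ interval lo c → lo < v × v ≤ lo + c
∈-interval⁻ lo (suc c) (here refl) = ≤-refl , subst (suc lo ≤_) (sym (+-suc lo c)) (s≤s (m≤m+n lo c))
∈-interval⁻ {v} lo (suc c) (there v∈) with ∈-interval⁻ (suc lo) c v∈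
... | lo< , ≤hi = <-trans (n<1+n lo) lo< , subst (v ≤_) (sym (+-suc lo c)) ≤hi

∈-interval⁺ : ∀ {v} lo c → lo < v → v ≤ lo + c → v ∈ interval lo c
∈-interval⁺ {v} lo zero lo<v v≤ = ⊥-elim (<⇒≱ lo<v (subst (v ≤_) (+-identityʳ lo) v≤))
∈-interval⁺ {v} lo (suc c) lo<v v≤ with v ≟ suc lo
... | yes refl = here refl
... | no v≢ = there (∈-interval⁺ (suc lo) c (≤∧≢⇒< lo<v (v≢ ∘ sym)) (subst (v ≤_) (+-suc lo c) v≤))

interval-Increasing : ∀ lo c → Increasing (interval lo c)
interval-Increasing lo zero = []
interval-Increasing lo (suc c) =
  All.tabulate (λ v∈ → proj₁ (∈-interval⁻ (suc lo) c v∈)) ∷ interval-Increasing (suc lo) c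

nth-interval : ∀ d lo c m → m < c → nth d (interval lo c) (suc m) ≡ lo + suc m
nth-interval d lo (suc c) zero _ = +-comm 1 lo
nth-interval d lo (suc c) (suc m) (s≤s m<) = trans (nth-interval d (suc lo) c m m<) (sym (+-suc lo (suc m)))

-- Like pos and vv: lo before the first entry and hi past the last one.
fencepost : ℕ → ℕ → List ℕ → ℕ → ℕ
fencepost lo hi zs zero = lo
fencepost lo hi zs (suc y) = nth hi zs (suc y)

fencepost-gap : ∀ lo hi zs v → lo < v → v < hi → v ∉ zs →
  ∃[ y ] (y ≤ length zs × fencepost lo hi zs y < v × v < fencepost lo hi zs (suc y))
fencepost-gap lo hi [] v lo<v v<hi _ = zero , z≤n , lo<v , v<hi
fencepost-gap lo hi (z ∷ zs) v lo<v v<hi v∉ with <-cmp v z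
... | tri< v<z _ _ = zero , z≤n , lo<v , v<z
... | tri≈ _ v≡z _ = ⊥-elim (v∉ (here v≡z))
... | tri> _ _ z<v with fencepost-gap z hi zs v z<v v<hi (v∉ ∘ there)
... | zero , _ , below , above = suc zero , s≤s z≤n , below , above
... | suc y , y≤ , below , above = suc (suc y) , s≤s y≤ , below , above

countBelow : ℕ → List ℕ → ℕ
countBelow c xs = length (filter (_<? c) xs)

countBelow-<-mono : ∀ {xs} → Unique xs → ∀ {a b} → a < b → a ∈ xs → countBelow a xs < countBelow b xs
countBelow-<-mono {xs} u {a} {b} a<b a∈xs =
  Unique-⊆⇒length< _≟_ {filter (_<? a) xs} {filter (_<? b) xs} (Unique.filter⁺ (_<? a) u)
    (λ z∈ → let (z∈xs , z<a) = ∈-filter⁻ (_<? a) {xs = xs} z∈ in ∈-filter⁺ (_<? b) z∈xs (<-trans z<a a<b))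
    (∈-filter⁺ (_<? b) a∈xs a<b)
    (λ a∈ → <-irrefl refl (proj₂ (∈-filter⁻ (_<? a) {xs = xs} a∈)))

countBelow-injectiveOn : ∀ {xs} → Unique xs → ∀ {x y} → x ∈ xs → y ∈ xs →
  countBelow x xs ≡ countBelow y xs → x ≡ y
countBelow-injectiveOn u {x} {y} x∈ y∈ e with <-cmp x y
... | tri< x<y _ _ = ⊥-elim (<-irrefl e (countBelow-<-mono u x<y x∈))
... | tri≈ _ x≡y _ = x≡y
... | tri> _ _ y<x = ⊥-elim (<-irrefl (sym e) (countBelow-<-mono u y<x y∈))

countBelow-⊆⊇ : ∀ c {xs ys} → Unique xs → Unique ys → xs ⊆ ys → ys ⊆ xs → countBelow c xs ≡ countBelow c ys
countBelow-⊆⊇ c {xs} {ys} ux uy xs⊆ys ys⊆xs =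
  Unique-⊆⊇⇒length≡ _≟_ {filter (_<? c) xs} {filter (_<? c) ys}
    (Unique.filter⁺ (_<? c) ux) (Unique.filter⁺ (_<? c) uy)
  (λ z∈ → let (z∈xs , z<c) = ∈-filter⁻ (_<? c) {xs = xs} z∈ in ∈-filter⁺ (_<? c) (xs⊆ys z∈xs) z<c)
  (λ z∈ → let (z∈ys , z<c) = ∈-filter⁻ (_<? c) {xs = ys} z∈ in ∈-filter⁺ (_<? c) (ys⊆xs z∈ys) z<c)

private
  zip-∈⇒nth : ∀ {x y} xs ys → (x , y) ∈ zip xs ys →
    ∃[ a ] (a < length xs × nth 0 xs (suc a) ≡ x × nth 0 ys (suc a) ≡ y)
  zip-∈⇒nth (x ∷ xs) (y ∷ ys) (here refl) = zero , s≤s z≤n , refl , refl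
  zip-∈⇒nth (x ∷ xs) (y ∷ ys) (there p∈) with zip-∈⇒nth xs ys p∈
  ... | a , a< , ex , ey = suc a , s≤s a< , ex , ey

  map-proj₁-zip : ∀ (xs ys : List ℕ) → length xs ≡ length ys → map proj₁ (zip xs ys) ≡ xs
  map-proj₁-zip [] [] _ = refl
  map-proj₁-zip (x ∷ xs) (y ∷ ys) e = cong (x ∷_) (map-proj₁-zip xs ys (suc-injective e))

  map-proj₂-zip : ∀ (xs ys : List ℕ) → length xs ≡ length ys → map proj₂ (zip xs ys) ≡ ys
  map-proj₂-zip [] [] _ = refl
  map-proj₂-zip (x ∷ xs) (y ∷ ys) e = cong (y ∷_) (map-proj₂-zip xs ys (suc-injective e))

-- An entry is determined by how many entries lie below it, and order-isomorphic
-- lists have the same such counts position by position.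
orderIsomorphic-⊆⊇⇒≡ : ∀ {xs ys} → length xs ≡ length ys → Unique xs → Unique ys →
  xs ⊆ ys → ys ⊆ xs →
  (∀ a b → a < length xs → b < length xs →
     (nth 0 xs (suc a) < nth 0 xs (suc b)) ⇔ (nth 0 ys (suc a) < nth 0 ys (suc b))) →
  xs ≡ ys
orderIsomorphic-⊆⊇⇒≡ {xs} {ys} |xs|≡|ys| ux uy xs⊆ys ys⊆xs iso = begin
  xs            ≡⟨ sym (map-proj₁-zip xs ys |xs|≡|ys|) ⟩
  map proj₁ zs  ≡⟨ Listₚ.map-cong-local (All.tabulate components-equal) ⟩
  map proj₂ zs  ≡⟨ map-proj₂-zip xs ys |xs|≡|ys| ⟩
  ys            ∎
  where
  open ≡-Reasoning
  zs = zip xs ys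

  countBelow-at : ∀ {a} → a < length xs →
    countBelow (nth 0 xs (suc a)) xs ≡ countBelow (nth 0 ys (suc a)) xs
  countBelow-at {a} a< = begin
    countBelow x xs                       ≡⟨ cong (countBelow x) (sym (map-proj₁-zip xs ys |xs|≡|ys|)) ⟩
    countBelow x (map proj₁ zs)           ≡⟨ length-filter-map (_<? x) proj₁ zs ⟩
    length (filter ((_<? x) ∘ proj₁) zs)  ≡⟨ length-filter-congOn _ _ zs below⇒ below⇐ ⟩
    length (filter ((_<? y) ∘ proj₂) zs)  ≡⟨ sym (length-filter-map (_<? y) proj₂ zs) ⟩
    countBelow y (map proj₂ zs)           ≡⟨ cong (countBelow y) (map-proj₂-zip xs ys |xs|≡|ys|) ⟩
    countBelow y ys                       ≡⟨ countBelow-⊆⊇ y uy ux ys⊆xs xs⊆ys ⟩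
    countBelow y xs                       ∎
    where
    x = nth 0 xs (suc a)
    y = nth 0 ys (suc a)
    below⇒ : ∀ {p} → p ∈ zs → proj₁ p < x → proj₂ p < y
    below⇒ p∈ with zip-∈⇒nth xs ys p∈
    ... | b , b< , refl , refl = Equivalence.to (iso b a b< a<)
    below⇐ : ∀ {p} → p ∈ zs → proj₂ p < y → proj₁ p < x
    below⇐ p∈ with zip-∈⇒nth xs ys p∈
    ... | b , b< , refl , refl = Equivalence.from (iso b a b< a<)

  components-equal : ∀ {p} → p ∈ zs → proj₁ p ≡ proj₂ p
  components-equal p∈ with zip-∈⇒nth xs ys p∈
  ... | a , a< , refl , refl =
    countBelow-injectiveOn ux (nth-∈ 0 xs a a<)
      (ys⊆xs (nth-∈ 0 ys a (subst (a <_) |xs|≡|ys| a<)))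
      (countBelow-at a<)

module _ {A : Set} where

  ∈-insertAt⁻ : ∀ {m z v} (xs : Vec A m) (p : Fin (suc m)) →
    z ∈ toList (insertAt xs p v) → z ≡ v ⊎ z ∈ toList xs
  ∈-insertAt⁻ xs Fin.zero (here z≡v) = inj₁ z≡v
  ∈-insertAt⁻ xs Fin.zero (there z∈) = inj₂ z∈
  ∈-insertAt⁻ (x ∷ xs) (Fin.suc p) (here z≡x) = inj₂ (here z≡x)
  ∈-insertAt⁻ (x ∷ xs) (Fin.suc p) (there z∈) = map₂ there (∈-insertAt⁻ xs p z∈)

  ∈-insertAt⁺ : ∀ {m z v} (xs : Vec A m) (p : Fin (suc m)) →
    z ∈ toList xs → z ∈ toList (insertAt xs p v)
  ∈-insertAt⁺ xs Fin.zero z∈ = there z∈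
  ∈-insertAt⁺ (x ∷ xs) (Fin.suc p) (here z≡x) = here z≡x
  ∈-insertAt⁺ (x ∷ xs) (Fin.suc p) (there z∈) = there (∈-insertAt⁺ xs p z∈)

  inserted-∈-insertAt : ∀ {m v} (xs : Vec A m) (p : Fin (suc m)) → v ∈ toList (insertAt xs p v)
  inserted-∈-insertAt xs Fin.zero = here refl
  inserted-∈-insertAt (x ∷ xs) (Fin.suc p) = there (inserted-∈-insertAt xs p)

  Unique-insertAt⁺ : ∀ {m v} (xs : Vec A m) (p : Fin (suc m)) →
    Unique (toList xs) → v ∉ toList xs → Unique (toList (insertAt xs p v))
  Unique-insertAt⁺ xs Fin.zero u v∉ = All.tabulate (λ z∈ v≡z → v∉ (subst (_∈ toList xs) (sym v≡z) z∈)) ∷ u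
  Unique-insertAt⁺ {v = v} (x ∷ xs) (Fin.suc p) (x∉ ∷ u) v∉ =
    All.tabulate (λ z∈ x≡z → x≢ (∈-insertAt⁻ xs p z∈) x≡z) ∷ Unique-insertAt⁺ xs p u (v∉ ∘ there)
    where
    x≢ : ∀ {z} → z ≡ v ⊎ z ∈ toList xs → x ≢ z
    x≢ (inj₁ refl) refl = v∉ (here refl)
    x≢ (inj₂ z∈) = All.lookup x∉ z∈

  Unique-insertAt⁻ : ∀ {m v} (xs : Vec A m) (p : Fin (suc m)) →
    Unique (toList (insertAt xs p v)) → Unique (toList xs) × v ∉ toList xs
  Unique-insertAt⁻ xs Fin.zero (v∉ ∷ u) = u , (λ v∈ → All.lookup v∉ v∈ refl)
  Unique-insertAt⁻ {v = v} (x ∷ xs) (Fin.suc p) (x∉ ∷ u) with Unique-insertAt⁻ xs p u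
  ... | u' , v∉xs = All.tabulate (All.lookup x∉ ∘ ∈-insertAt⁺ xs p) ∷ u' , v∉
    where
    v∉ : v ∉ x ∷ toList xs
    v∉ (here refl) = All.lookup x∉ (inserted-∈-insertAt xs p) refl
    v∉ (there v∈) = v∉xs v∈

  filter-insertAt-reject : ∀ {m v} {P : Pred A 0ℓ} (P? : Decidable P) → ¬ P v →
    (xs : Vec A m) (p : Fin (suc m)) → filter P? (toList (insertAt xs p v)) ≡ filter P? (toList xs)
  filter-insertAt-reject P? ¬Pv xs Fin.zero = Listₚ.filter-reject P? ¬Pv
  filter-insertAt-reject P? ¬Pv (x ∷ xs) (Fin.suc p) with P? x
  ... | yes _ = cong (x ∷_) (filter-insertAt-reject P? ¬Pv xs p)
  ... | no _ = filter-insertAt-reject P? ¬Pv xs p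

  insertAt-injective : ∀ {m v} (xs ys : Vec A m) (p q : Fin (suc m)) → v ∉ toList xs → v ∉ toList ys →
    insertAt xs p v ≡ insertAt ys q v → xs ≡ ys × p ≡ q
  insertAt-injective xs ys Fin.zero Fin.zero _ _ refl = refl , refl
  insertAt-injective xs (y ∷ ys) Fin.zero (Fin.suc q) _ v∉ys refl = ⊥-elim (v∉ys (here refl))
  insertAt-injective (x ∷ xs) ys (Fin.suc p) Fin.zero v∉xs _ refl = ⊥-elim (v∉xs (here refl))
  insertAt-injective (x ∷ xs) (y ∷ ys) (Fin.suc p) (Fin.suc q) v∉xs v∉ys e with Vecₚ.∷-injective e
  ... | refl , e' with insertAt-injective xs ys p q (v∉xs ∘ there) (v∉ys ∘ there) e'
  ... | refl , refl = refl , refl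

  ∈⇒insertAt : ∀ {m v} (τ : Vec A (suc m)) → v ∈ toList τ →
    Σ (Vec A m) λ xs → Σ (Fin (suc m)) λ p → τ ≡ insertAt xs p v
  ∈⇒insertAt (x ∷ xs) (here refl) = xs , Fin.zero , refl
  ∈⇒insertAt {suc m} (x ∷ xs) (there v∈) with ∈⇒insertAt xs v∈
  ... | ys , p , refl = x ∷ ys , Fin.suc p , refl
  ∈⇒insertAt {zero} (x ∷ []) (there ())

module _ {P : Pred ℕ 0ℓ} (P? : Decidable P) where

  positions : List ℕ → List ℕ
  positions [] = []
  positions (x ∷ xs) with P? x
  ... | yes _ = 1 ∷ map suc (positions xs)
  ... | no _ = map suc (positions xs)

  mutual
    ∈-positions⁻ : ∀ xs {m} → m ∈ positions xs →
      ∃[ m' ] (m ≡ suc m' × m' < length xs × P (nth 0 xs (suc m')))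
    ∈-positions⁻ (x ∷ xs) m∈ with P? x
    ∈-positions⁻ (x ∷ xs) (here refl) | yes px = zero , refl , s≤s z≤n , px
    ∈-positions⁻ (x ∷ xs) (there m∈) | yes _ = ∈-positions-shifted⁻ x xs m∈
    ∈-positions⁻ (x ∷ xs) m∈ | no _ = ∈-positions-shifted⁻ x xs m∈

    ∈-positions-shifted⁻ : ∀ x xs {m} → m ∈ map suc (positions xs) →
      ∃[ m' ] (m ≡ suc m' × m' < suc (length xs) × P (nth 0 (x ∷ xs) (suc m')))
    ∈-positions-shifted⁻ x xs m∈ with ∈-map⁻ suc m∈
    ... | _ , m₁∈ , refl with ∈-positions⁻ xs m₁∈
    ... | m' , refl , m'< , pm = suc m' , refl , s≤s m'< , pm

  ∈-positions⁺ : ∀ xs m → m < length xs → P (nth 0 xs (suc m)) → suc m ∈ positions xs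
  ∈-positions⁺ (x ∷ xs) zero _ px with P? x
  ... | yes _ = here refl
  ... | no ¬px = ⊥-elim (¬px px)
  ∈-positions⁺ (x ∷ xs) (suc m) (s≤s m<) pm with P? x
  ... | yes _ = there (∈-map⁺ suc (∈-positions⁺ xs m m< pm))
  ... | no _ = ∈-map⁺ suc (∈-positions⁺ xs m m< pm)

  private
    positions-positive : ∀ xs → All (0 <_) (positions xs)
    positions-positive xs = All.tabulate λ m∈ →
      let (_ , m≡ , _) = ∈-positions⁻ xs m∈ in subst (0 <_) (sym m≡) (s≤s z≤n)

    map-nth-shift : ∀ x xs ms → All (0 <_) ms → map (nth 0 (x ∷ xs)) (map suc ms) ≡ map (nth 0 xs) ms
    map-nth-shift x xs [] _ = refl
    map-nth-shift x xs (suc m ∷ ms) (_ ∷ ms>0) = cong (nth 0 xs (suc m) ∷_) (map-nth-shift x xs ms ms>0)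

  positions-Increasing : ∀ xs → Increasing (positions xs)
  positions-Increasing [] = []
  positions-Increasing (x ∷ xs) with P? x
  ... | yes _ = All.tabulate (λ m∈ → let (m , m∈' , m≡) = ∈-map⁻ suc m∈ in
                   subst (1 <_) (sym m≡) (s≤s (All.lookup (positions-positive xs) m∈')))
                ∷ AllPairs.map⁺ (AllPairs.map s≤s (positions-Increasing xs))
  ... | no _ = AllPairs.map⁺ (AllPairs.map s≤s (positions-Increasing xs))

  map-nth-positions : ∀ xs → map (nth 0 xs) (positions xs) ≡ filter P? xs
  map-nth-positions [] = refl
  map-nth-positions (x ∷ xs) with P? x
  ... | yes _ = cong (x ∷_) (trans (map-nth-shift x xs _ (positions-positive xs)) (map-nth-positions xs))
  ... | no _ = trans (map-nth-shift x xs _ (positions-positive xs)) (map-nth-positions xs)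

  length-positions : ∀ xs → length (positions xs) ≡ length (filter P? xs)
  length-positions xs =
    trans (sym (Listₚ.length-map (nth 0 xs) (positions xs))) (cong length (map-nth-positions xs))

module Window (i d : ℕ) where

  Outer : ℕ → Set
  Outer v = v ≤ i ⊎ i + d < v

  Inner : ℕ → Set
  Inner v = i < v × v ≤ i + d

  outer? : Decidable Outer
  outer? v = (v ≤? i) ⊎-dec (i + d <? v)

  inner? : Decidable Inner
  inner? v = (i <? v) ×-dec (v ≤? i + d)

  outer⊎inner : ∀ v → Outer v ⊎ Inner v
  outer⊎inner v with v ≤? i | v ≤? i + d
  ... | yes v≤i | _ = inj₁ (inj₁ v≤i)
  ... | no v≰i | yes v≤i+d = inj₂ (≰⇒> v≰i , v≤i+d)
  ... | no _ | no v≰i+d = inj₁ (inj₂ (≰⇒> v≰i+d))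

  outer⇒¬inner : ∀ {v} → Outer v → ¬ Inner v
  outer⇒¬inner (inj₁ v≤i) (i<v , _) = <⇒≱ i<v v≤i
  outer⇒¬inner (inj₂ i+d<v) (_ , v≤i+d) = <⇒≱ i+d<v v≤i+d

  spread : ℕ → ℕ
  spread v with v ≤? i
  ... | yes _ = v
  ... | no _ = v + d

  spread-≤ : ∀ {x} → x ≤ i → spread x ≡ x
  spread-≤ {x} x≤i with x ≤? i
  ... | yes _ = refl
  ... | no x≰i = ⊥-elim (x≰i x≤i)

  spread-> : ∀ {x} → i < x → spread x ≡ x + d
  spread-> {x} i<x with x ≤? i
  ... | yes x≤i = ⊥-elim (<⇒≱ i<x x≤i)
  ... | no _ = refl

  spread-<-mono : ∀ {x y} → x < y → spread x < spread y
  spread-<-mono {x} {y} x<y with x ≤? i | y ≤? i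
  ... | yes _ | yes _ = x<y
  ... | yes _ | no _ = ≤-trans x<y (m≤m+n y d)
  ... | no x≰i | yes y≤i = ⊥-elim (x≰i (≤-trans (<⇒≤ x<y) y≤i))
  ... | no _ | no _ = +-monoˡ-< d x<y

  spread-<-reflect : ∀ {x y} → spread x < spread y → x < y
  spread-<-reflect {x} {y} fx<fy with <-cmp x y
  ... | tri< x<y _ _ = x<y
  ... | tri≈ _ refl _ = ⊥-elim (<-irrefl refl fx<fy)
  ... | tri> _ _ y<x = ⊥-elim (<-asym fx<fy (spread-<-mono y<x))

  spread-injective : ∀ {x y} → spread x ≡ spread y → x ≡ y
  spread-injective {x} {y} e with <-cmp x y
  ... | tri< x<y _ _ = ⊥-elim (<-irrefl e (spread-<-mono x<y))
  ... | tri≈ _ x≡y _ = x≡y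
  ... | tri> _ _ y<x = ⊥-elim (<-irrefl (sym e) (spread-<-mono y<x))

  spread-Outer : ∀ x → Outer (spread x)
  spread-Outer x with x ≤? i
  ... | yes x≤i = inj₁ x≤i
  ... | no x≰i = inj₂ (+-monoˡ-< d (≰⇒> x≰i))

  spread-range : ∀ {k x} → 1 ≤ x → x ≤ k → 1 ≤ spread x × spread x ≤ d + k
  spread-range {k} {x} 1≤x x≤k with x ≤? i
  ... | yes _ = 1≤x , ≤-trans x≤k (m≤n+m k d)
  ... | no _ = ≤-trans 1≤x (m≤m+n x d) , subst (x + d ≤_) (+-comm k d) (+-monoˡ-≤ d x≤k)

  Outer⇒∈spread-interval : ∀ {k} → i ≤ k → ∀ {z} → 1 ≤ z → z ≤ d + k → Outer z →
    z ∈ map spread (interval 0 k)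
  Outer⇒∈spread-interval i≤k 1≤z _ (inj₁ z≤i) =
    subst (_∈ _) (spread-≤ z≤i) (∈-map⁺ spread (∈-interval⁺ 0 _ 1≤z (≤-trans z≤i i≤k)))
  Outer⇒∈spread-interval {k} _ {z} _ z≤d+k (inj₂ i+d<z) =
    subst (_∈ _) (trans (spread-> i<y) (m∸n+n≡m d≤z))
      (∈-map⁺ spread (∈-interval⁺ 0 k (≤-trans (s≤s z≤n) i<y) y≤k))
    where
    y = z ∸ d
    d≤z : d ≤ z
    d≤z = ≤-trans (m≤n+m d i) (<⇒≤ i+d<z)
    i<y : i < y
    i<y = +-cancelʳ-≤ d (suc i) y (subst (suc (i + d) ≤_) (sym (m∸n+n≡m d≤z)) i+d<z)
    y≤k : y ≤ k
    y≤k = +-cancelʳ-≤ d y k (subst₂ _≤_ (sym (m∸n+n≡m d≤z)) (+-comm d k) z≤d+k)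

module Arrangements (i d : ℕ) {k : ℕ} (w : Vec ℕ k)
                    (w-Unique : Unique (toList w)) (w-Outer : All (Window.Outer i d) (toList w)) where

  open Window i d

  Admissible : ℕ → ℕ → Set
  Admissible j v = Outer v ⊎ (i < v × v ≤ i + j)

  Arrangement : (j : ℕ) → Vec ℕ (j + k) → Set
  Arrangement j τ = Unique (toList τ) × All (Admissible j) (toList τ) × filter outer? (toList τ) ≡ toList w

  insertNext : (j : ℕ) → Vec ℕ (j + k) → Fin (suc (j + k)) → Vec ℕ (suc j + k)
  insertNext j τ p = insertAt τ p (suc (i + j))

  arrangements : (j : ℕ) → List (Vec ℕ (j + k))
  arrangements zero = w ∷ []
  arrangements (suc j) = cartesianProductWith (insertNext j) (arrangements j) (allFin (suc (j + k)))

  next-Inner : ∀ {j} → j < d → Inner (suc (i + j))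
  next-Inner {j} j<d = s≤s (m≤m+n i j) , subst (_≤ i + d) (+-suc i j) (+-monoʳ-≤ i j<d)

  next-∉ : ∀ {j} (τ : Vec ℕ (j + k)) → j < d → All (Admissible j) (toList τ) → suc (i + j) ∉ toList τ
  next-∉ τ j<d adm v∈ with All.lookup adm v∈
  ... | inj₁ outer = outer⇒¬inner outer (next-Inner j<d)
  ... | inj₂ (_ , v≤i+j) = <-irrefl refl v≤i+j

  Arrangement-insertNext : ∀ {j} (τ : Vec ℕ (j + k)) (p : Fin (suc (j + k))) → j < d →
    Arrangement j τ → Arrangement (suc j) (insertNext j τ p)
  Arrangement-insertNext {j} τ p j<d (u , adm , outer≡w) =
    Unique-insertAt⁺ τ p u (next-∉ τ j<d adm) ,
    All.tabulate (λ v∈ → admissible (∈-insertAt⁻ τ p v∈)) ,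
    trans (filter-insertAt-reject outer? (λ outer → outer⇒¬inner outer (next-Inner j<d)) τ p) outer≡w
    where
    admissible : ∀ {v} → v ≡ suc (i + j) ⊎ v ∈ toList τ → Admissible (suc j) v
    admissible (inj₁ refl) = inj₂ (s≤s (m≤m+n i j) , ≤-reflexive (sym (+-suc i j)))
    admissible (inj₂ v∈) with All.lookup adm v∈
    ... | inj₁ outer = inj₁ outer
    ... | inj₂ (i<v , v≤i+j) = inj₂ (i<v , ≤-trans v≤i+j (+-monoʳ-≤ i (n≤1+n j)))

  Arrangement-removeNext : ∀ {j} (τ : Vec ℕ (j + k)) (p : Fin (suc (j + k))) → j < d →
    Arrangement (suc j) (insertNext j τ p) → Arrangement j τ
  Arrangement-removeNext {j} τ p j<d (u , adm , outer≡w) =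
    proj₁ u' ,
    All.tabulate (λ v∈ → admissible (All.lookup adm (∈-insertAt⁺ τ p v∈)) λ { refl → proj₂ u' v∈ }) ,
    trans (sym (filter-insertAt-reject outer? (λ outer → outer⇒¬inner outer (next-Inner j<d)) τ p)) outer≡w
    where
    u' = Unique-insertAt⁻ τ p u
    admissible : ∀ {v} → Admissible (suc j) v → v ≢ suc (i + j) → Admissible j v
    admissible (inj₁ outer) _ = inj₁ outer
    admissible {v} (inj₂ (i<v , v≤)) v≢ = inj₂ (i<v , ≤-pred (≤∧≢⇒< (subst (v ≤_) (+-suc i j) v≤) v≢))

  length-inner-entries : ∀ {j} (τ : Vec ℕ (j + k)) → Arrangement j τ → length (filter inner? (toList τ)) ≡ j
  length-inner-entries {j} τ (_ , _ , outer≡w) = +-cancelˡ-≡ k _ _ (begin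
    k + length (filter inner? (toList τ))
      ≡⟨ cong (_+ length (filter inner? (toList τ))) (sym (trans (cong length outer≡w) (Vecₚ.length-toList w))) ⟩
    length (filter outer? (toList τ)) + length (filter inner? (toList τ))
      ≡⟨ length-filter-complementary outer? inner? outer⊎inner outer⇒¬inner (toList τ) ⟩
    length (toList τ)
      ≡⟨ Vecₚ.length-toList τ ⟩
    j + k
      ≡⟨ +-comm j k ⟩
    k + j ∎)
    where open ≡-Reasoning

  -- Otherwise its j + 1 inner entries would fit among the j values i+1, …, i+j.
  next-∈ : ∀ {j} (τ : Vec ℕ (suc j + k)) → Arrangement (suc j) τ → suc (i + j) ∈ toList τ
  next-∈ {j} τ a@(u , adm , _) with any? (suc (i + j) ≟_) (toList τ)
  ... | yes v∈ = v∈
  ... | no v∉ = ⊥-elim (1+n≰n (begin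
    suc j                                  ≡⟨ sym (length-inner-entries τ a) ⟩
    length (filter inner? (toList τ))      ≤⟨ Unique-⊆⇒length≤ _≟_ (Unique.filter⁺ inner? u) inner⊆ ⟩
    length (interval i j)                  ≡⟨ length-interval i j ⟩
    j                                      ∎))
    where
    open ≤-Reasoning
    inner⊆ : filter inner? (toList τ) ⊆ interval i j
    inner⊆ {v} v∈ with ∈-filter⁻ inner? {xs = toList τ} v∈
    ... | v∈τ , inner with All.lookup adm v∈τ
    ... | inj₁ outer = ⊥-elim (outer⇒¬inner outer inner)
    ... | inj₂ (i<v , v≤) = ∈-interval⁺ i j i<v
          (≤-pred (≤∧≢⇒< (subst (v ≤_) (+-suc i j) v≤) λ { refl → v∉ v∈τ }))

  arrangements-sound : ∀ {j} → j ≤ d → ∀ {τ} → τ ∈ arrangements j → Arrangement j τ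
  arrangements-sound {zero} _ (here refl) = w-Unique , All.map inj₁ w-Outer , Listₚ.filter-all outer? w-Outer
  arrangements-sound {suc j} j<d τ∈
    with ∈-cartesianProductWith⁻ (insertNext j) (arrangements j) (allFin (suc (j + k))) τ∈
  ... | τ₀ , p , τ₀∈ , _ , refl = Arrangement-insertNext τ₀ p j<d (arrangements-sound (<⇒≤ j<d) τ₀∈)

  arrangements-complete : ∀ {j} → j ≤ d → ∀ τ → Arrangement j τ → τ ∈ arrangements j
  arrangements-complete {zero} _ τ (_ , adm , outer≡w) =
    here (trans (sym (Vecₚ.cast-is-id refl τ))
                (Vecₚ.toList-injective refl τ w (trans (sym (Listₚ.filter-all outer? (All.map outer adm))) outer≡w)))
    where
    outer : ∀ {v} → Admissible 0 v → Outer v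
    outer (inj₁ outer-v) = outer-v
    outer (inj₂ (i<v , v≤i+0)) = ⊥-elim (<⇒≱ i<v (subst (_ ≤_) (+-identityʳ i) v≤i+0))
  arrangements-complete {suc j} j<d τ a with ∈⇒insertAt τ (next-∈ τ a)
  ... | τ₀ , p , refl =
    ∈-cartesianProductWith⁺ (insertNext j)
      (arrangements-complete (<⇒≤ j<d) τ₀ (Arrangement-removeNext τ₀ p j<d a)) (∈-allFin p)

  arrangements-Unique : ∀ {j} → j ≤ d → Unique (arrangements j)
  arrangements-Unique {zero} _ = [] ∷ []
  arrangements-Unique {suc j} j<d =
    Unique-cartesianProductWith-injectiveOn (insertNext j) (arrangements-Unique (<⇒≤ j<d)) (Unique.allFin⁺ _)
      (λ {τ} {τ'} {p} {q} τ∈ τ'∈ → insertAt-injective τ τ' p q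
        (next-∉ τ j<d (proj₁ (proj₂ (arrangements-sound (<⇒≤ j<d) τ∈))))
        (next-∉ τ' j<d (proj₁ (proj₂ (arrangements-sound (<⇒≤ j<d) τ'∈)))))

  length-arrangements : ∀ j → length (arrangements j) * k ! ≡ (j + k) !
  length-arrangements zero = +-identityʳ (k !)
  length-arrangements (suc j) = begin
    length (arrangements (suc j)) * k !
      ≡⟨ cong (_* k !) (length-cartesianProductWith (insertNext j) (arrangements j) (allFin (suc (j + k)))) ⟩
    length (arrangements j) * length (allFin (suc (j + k))) * k !
      ≡⟨ cong (λ m → length (arrangements j) * m * k !) (Listₚ.length-tabulate {n = suc (j + k)} id) ⟩
    length (arrangements j) * suc (j + k) * k !      ≡⟨ xy∙z≈y∙xz (length (arrangements j)) (suc (j + k)) (k !) ⟩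
    suc (j + k) * (length (arrangements j) * k !)    ≡⟨ cong (suc (j + k) *_) (length-arrangements j) ⟩
    suc (j + k) * (j + k) !                          ∎
    where open ≡-Reasoning

module Characterisation {k : ℕ} (i d : ℕ) (i≤k : i ≤ k) (π : Vec ℕ k) (π-perm : IsPerm k π) where

  open Window i d

  n : ℕ
  n = d + k

  R : ℕ → ℕ → Set
  R = allRowsBut k i

  spreadπ : List ℕ
  spreadπ = map spread (toList π)

  outerValues : List ℕ
  outerValues = map spread (interval 0 k)

  length-π : length (toList π) ≡ k
  length-π = Vecₚ.length-toList π

  length-spreadπ : length spreadπ ≡ k
  length-spreadπ = trans (Listₚ.length-map spread (toList π)) length-π

  π⊆interval : toList π ⊆ interval 0 k
  π⊆interval v∈ = let (1≤v , v≤k) = All.lookup (proj₂ π-perm) v∈ in ∈-interval⁺ 0 k 1≤v v≤k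

  interval⊆π : interval 0 k ⊆ toList π
  interval⊆π = Unique-⊆-length≥⇒⊇ _≟_ (proj₁ π-perm) π⊆interval
                 (≤-reflexive (trans (length-interval 0 k) (sym length-π)))

  spreadπ-Unique : Unique spreadπ
  spreadπ-Unique = Unique.map⁺ spread-injective (proj₁ π-perm)

  spreadπ-Outer : All Outer spreadπ
  spreadπ-Outer = All.tabulate λ v∈ →
    let (x , _ , v≡) = ∈-map⁻ spread v∈ in subst Outer (sym v≡) (spread-Outer x)

  spreadπ-range : All (λ v → 1 ≤ v × v ≤ n) spreadπ
  spreadπ-range = All.tabulate λ v∈ →
    let (x , x∈ , v≡) = ∈-map⁻ spread v∈
        (1≤x , x≤k) = All.lookup (proj₂ π-perm) x∈
    in subst (λ v → 1 ≤ v × v ≤ n) (sym v≡) (spread-range 1≤x x≤k)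

  spreadπ⊆outerValues : spreadπ ⊆ outerValues
  spreadπ⊆outerValues v∈ = let (x , x∈ , v≡) = ∈-map⁻ spread v∈ in
    subst (_∈ outerValues) (sym v≡) (∈-map⁺ spread (π⊆interval x∈))

  outerValues⊆spreadπ : outerValues ⊆ spreadπ
  outerValues⊆spreadπ v∈ = let (x , x∈ , v≡) = ∈-map⁻ spread v∈ in
    subst (_∈ spreadπ) (sym v≡) (∈-map⁺ spread (interval⊆π x∈))

  outerValues-Increasing : Increasing outerValues
  outerValues-Increasing = AllPairs.map⁺ (AllPairs.map spread-<-mono (interval-Increasing 0 k))

  nth-outerValues : ∀ {y} → 1 ≤ y → y ≤ k → nth (suc n) outerValues y ≡ spread y
  nth-outerValues {suc y} _ y<k = begin
    nth (suc n) (map spread (interval 0 k)) (suc y)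
      ≡⟨ nth-map 0 (suc n) spread (interval 0 k) y (subst (y <_) (sym (length-interval 0 k)) y<k) ⟩
    spread (nth 0 (interval 0 k) (suc y))
      ≡⟨ cong spread (nth-interval 0 0 k y y<k) ⟩
    spread (suc y)
      ∎
    where open ≡-Reasoning

  module OuterPositions (τ : Vec ℕ n) (τ-perm : IsPerm n τ) (outer≡ : filter outer? (toList τ) ≡ spreadπ) where

    t : List ℕ
    t = toList τ

    length-t : length t ≡ n
    length-t = Vecₚ.length-toList τ

    length-positions-outer : length (positions outer? t) ≡ k
    length-positions-outer = trans (length-positions outer? t) (trans (cong length outer≡) length-spreadπ)

    ι : Vec ℕ k
    ι = cast length-positions-outer (fromList (positions outer? t))

    toList-ι : toList ι ≡ positions outer? t
    toList-ι = trans (Vecₚ.toList-cast length-positions-outer _) (Vecₚ.toList∘fromList _)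

    length-ι : length (toList ι) ≡ k
    length-ι = Vecₚ.length-toList ι

    <k⇒<length-ι : ∀ {a} → a < k → a < length (toList ι)
    <k⇒<length-ι {a} = subst (a <_) (sym length-ι)

    ∈ι⇒outer : ∀ {z} → z ∈ toList ι → ∃[ m ] (z ≡ suc m × m < n × Outer (nth 0 t (suc m)))
    ∈ι⇒outer z∈ with ∈-positions⁻ outer? t (subst (_ ∈_) toList-ι z∈)
    ... | m , z≡ , m< , outer = m , z≡ , subst (m <_) length-t m< , outer

    ∉ι⇒inner : ∀ m → m < n → suc m ∉ toList ι → Inner (nth 0 t (suc m))
    ∉ι⇒inner m m<n m∉ with outer⊎inner (nth 0 t (suc m))
    ... | inj₂ inner = inner
    ... | inj₁ outer = ⊥-elim (m∉ (subst (_ ∈_) (sym toList-ι)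
                                    (∈-positions⁺ outer? t m (subst (m <_) (sym length-t) m<n) outer)))

    ι-Increasing : Increasing (toList ι)
    ι-Increasing = subst Increasing (sym toList-ι) (positions-Increasing outer? t)

    occVals≡spreadπ : occVals π R τ ι ≡ spreadπ
    occVals≡spreadπ = trans (cong (map (nth 0 t)) toList-ι) (trans (map-nth-positions outer? t) outer≡)

    val-at-ι : ∀ {a} → 1 ≤ a → a ≤ k → val τ (pos π R τ ι a) ≡ spread (nth 0 (toList π) a)
    val-at-ι {suc a} _ a<k = begin
      nth 0 t (nth (suc n) (toList ι) (suc a))    ≡⟨ sym (nth-map (suc n) 0 (nth 0 t) (toList ι) a (<k⇒<length-ι a<k)) ⟩
      nth 0 (occVals π R τ ι) (suc a)             ≡⟨ cong (λ vs → nth 0 vs (suc a)) occVals≡spreadπ ⟩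
      nth 0 spreadπ (suc a)                       ≡⟨ nth-map 0 0 spread (toList π) a (subst (a <_) (sym length-π) a<k) ⟩
      spread (nth 0 (toList π) (suc a))           ∎
      where open ≡-Reasoning

    sort-occVals : sort (occVals π R τ ι) ≡ outerValues
    sort-occVals = Increasing-⊆⊇⇒≡
      (sort-Increasing (subst Unique (sym occVals≡spreadπ) spreadπ-Unique)) outerValues-Increasing
      (λ v∈ → spreadπ⊆outerValues (subst (_ ∈_) occVals≡spreadπ (∈-sort⁻ _ v∈)))
      (λ v∈ → ∈-sort⁺ _ (subst (_ ∈_) (sym occVals≡spreadπ) (outerValues⊆spreadπ v∈)))

    vv≡spread : ∀ {y} → 1 ≤ y → y ≤ k → vv π R τ ι y ≡ spread y
    vv≡spread {suc y} 1≤y y<k =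
      trans (cong (λ vs → nth (suc n) vs (suc y)) sort-occVals) (nth-outerValues 1≤y y<k)

    pos-≤ : ∀ {x} → x ≤ k → pos π R τ ι (suc x) ≤ suc n
    pos-≤ {x} x≤k with m≤n⇒m<n∨m≡n x≤k
    ... | inj₁ x<k = let (m , z≡ , m<n , _) = ∈ι⇒outer (nth-∈ (suc n) (toList ι) x (<k⇒<length-ι x<k)) in
                     ≤-trans (≤-reflexive z≡) (<⇒≤ (s≤s m<n))
    ... | inj₂ refl = ≤-reflexive (nth-≥length (suc n) (toList ι) k (≤-reflexive length-ι))

    between-positions-∉ι : ∀ {x m} → x ≤ k → pos π R τ ι x < m → m < pos π R τ ι (suc x) → m ∉ toList ι
    between-positions-∉ι {x} x≤k x< <x+1 m∈ with ∈⇒nth (suc n) (toList ι) m∈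
    ... | c , c< , refl with x ≤? c
    ... | yes x≤c = <-irrefl refl (≤-trans <x+1 (nth-≤-mono (suc n) ι-Increasing x≤c c<))
    between-positions-∉ι {suc x} x≤k x< <x+1 m∈ | c , c< , refl | no x≰c =
      <-irrefl refl (≤-trans x< (nth-≤-mono (suc n) ι-Increasing (≤-pred (≰⇒> x≰c)) (<k⇒<length-ι x≤k)))
    between-positions-∉ι {zero} _ _ _ _ | _ | no x≰c = x≰c z≤n

    positions-bounded : (a : ℕ) → 1 ≤ a → a ≤ k → 1 ≤ pos π R τ ι a × pos π R τ ι a ≤ n
    positions-bounded (suc a) _ a<k with ∈ι⇒outer (nth-∈ (suc n) (toList ι) a (<k⇒<length-ι a<k))
    ... | m , z≡ , m<n , _ = subst (λ z → 1 ≤ z × z ≤ n) (sym z≡) (s≤s z≤n , m<n)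

    positions-increasing : (a b : ℕ) → 1 ≤ a → a < b → b ≤ k → pos π R τ ι a < pos π R τ ι b
    positions-increasing (suc a) (suc b) _ (s≤s a<b) b<k =
      nth-<-mono (suc n) ι-Increasing a<b (<k⇒<length-ι b<k)

    order-isomorphic : (a b : ℕ) → 1 ≤ a → a ≤ k → 1 ≤ b → b ≤ k →
      (val τ (pos π R τ ι a) < val τ (pos π R τ ι b)) ⇔ (nth 0 (toList π) a < nth 0 (toList π) b)
    order-isomorphic a b 1≤a a≤k 1≤b b≤k rewrite val-at-ι 1≤a a≤k | val-at-ι 1≤b b≤k =
      mk⇔ spread-<-reflect spread-<-mono

    between-positions⇒inner : ∀ {x m} → x ≤ k → pos π R τ ι x < suc m → suc m < pos π R τ ι (suc x) →
      Inner (val τ (suc m))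
    between-positions⇒inner x≤k x< <x+1 =
      ∉ι⇒inner _ (≤-pred (≤-trans <x+1 (pos-≤ x≤k))) (between-positions-∉ι x≤k x< <x+1)

    shaded-boxes-empty : (x y : ℕ) → x ≤ k → y ≤ k → R x y →
      ¬ (∃[ m ] (pos π R τ ι x < m × m < pos π R τ ι (suc x) ×
                 vv π R τ ι y < val τ m × val τ m < vv π R τ ι (suc y)))
    shaded-boxes-empty x y x≤k y≤k (_ , _ , y≢i) (zero , () , _)
    shaded-boxes-empty x y x≤k y≤k (_ , _ , y≢i) (suc m , x< , <x+1 , y< , <y+1)
      with <-cmp y i | between-positions⇒inner x≤k x< <x+1
    ... | tri≈ _ y≡i _ | _ = y≢i y≡i
    ... | tri< y<i _ _ | i<v , _ = <-asym i<v (begin-strict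
      val τ (suc m)       <⟨ <y+1 ⟩
      vv π R τ ι (suc y)  ≡⟨ vv≡spread (s≤s z≤n) (≤-trans y<i i≤k) ⟩
      spread (suc y)      ≡⟨ spread-≤ y<i ⟩
      suc y               ≤⟨ y<i ⟩
      i                   ∎)
      where open ≤-Reasoning
    ... | tri> _ _ i<y | _ , v≤i+d = <-irrefl refl (begin-strict
      vv π R τ ι y        <⟨ y< ⟩
      val τ (suc m)       ≤⟨ v≤i+d ⟩
      i + d               <⟨ +-monoˡ-< d i<y ⟩
      y + d               ≡⟨ sym (trans (vv≡spread (≤-trans (s≤s z≤n) i<y) y≤k) (spread-> i<y)) ⟩
      vv π R τ ι y        ∎)
      where open ≤-Reasoning

    contains : Contains π R τ
    contains = ι , positions-bounded , positions-increasing , order-isomorphic , shaded-boxes-empty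

  module OccurrenceValues (τ : Vec ℕ n) (τ-perm : IsPerm n τ) (ι : Vec ℕ k) (occ : IsOccurrence π R τ ι) where

    t : List ℕ
    t = toList τ

    ps : List ℕ
    ps = toList ι

    length-t : length t ≡ n
    length-t = Vecₚ.length-toList τ

    length-ps : length ps ≡ k
    length-ps = Vecₚ.length-toList ι

    vvι : ℕ → ℕ
    vvι = vv π R τ ι

    private
      <n⇒<length-t : ∀ {m} → m < n → m < length t
      <n⇒<length-t {m} = subst (m <_) (sym length-t)

      position-form : ∀ {z} → 1 ≤ z → z ≤ n → ∃[ m ] (z ≡ suc m × m < n)
      position-form {suc m} _ m<n = m , refl , m<n

    ps-Increasing : Increasing ps
    ps-Increasing = nth-<-mono⇒Increasing (suc n) ps λ {a} {b} a<b b< →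
      proj₁ (proj₂ occ) (suc a) (suc b) (s≤s z≤n) (s≤s a<b) (subst (b <_) length-ps b<)

    ∈ps⇒position : ∀ {z} → z ∈ ps → ∃[ m ] (z ≡ suc m × m < n)
    ∈ps⇒position z∈ with ∈⇒nth (suc n) ps z∈
    ... | a , a< , refl = let (1≤z , z≤bound) = proj₁ occ (suc a) (s≤s z≤n) (subst (a <_) length-ps a<) in
                          position-form 1≤z z≤bound

    O : List ℕ
    O = occVals π R τ ι

    O-Unique : Unique O
    O-Unique = Unique-map⁺-injectiveOn (nth 0 t) (Increasing⇒Unique ps-Increasing) injective
      where
      injective : ∀ {a b} → a ∈ ps → b ∈ ps → nth 0 t a ≡ nth 0 t b → a ≡ b
      injective a∈ b∈ e with ∈ps⇒position a∈ | ∈ps⇒position b∈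
      ... | a , refl , a<n | b , refl , b<n =
        cong suc (nth-injective 0 (proj₁ τ-perm) (<n⇒<length-t a<n) (<n⇒<length-t b<n) e)

    O⊆t : O ⊆ t
    O⊆t v∈ with ∈-map⁻ (nth 0 t) v∈
    ... | p , p∈ , refl with ∈ps⇒position p∈
    ... | m , refl , m<n = nth-∈ 0 t m (<n⇒<length-t m<n)

    length-O : length O ≡ k
    length-O = trans (Listₚ.length-map (nth 0 t) ps) length-ps

    off-occurrence-∉O : ∀ {m} → m < n → suc m ∉ ps → val τ (suc m) ∉ O
    off-occurrence-∉O {m} m<n m∉ v∈ with ∈-map⁻ (nth 0 t) v∈
    ... | p , p∈ , e with ∈ps⇒position p∈
    ... | m' , refl , m'<n with nth-injective 0 (proj₁ τ-perm) (<n⇒<length-t m<n) (<n⇒<length-t m'<n) e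
    ... | refl = m∉ p∈

    S : List ℕ
    S = sort O

    S-Increasing : Increasing S
    S-Increasing = sort-Increasing O-Unique

    length-S : length S ≡ k
    length-S = trans (length-sort O) length-O

    S-range : ∀ {z} → z ∈ S → 1 ≤ z × z ≤ n
    S-range z∈ = All.lookup (proj₂ τ-perm) (O⊆t (∈-sort⁻ O z∈))

    fencepost≡pos : ∀ x → fencepost 0 (suc n) ps x ≡ pos π R τ ι x
    fencepost≡pos zero = refl
    fencepost≡pos (suc x) = refl

    fencepost≡vv : ∀ y → fencepost 0 (suc n) S y ≡ vvι y
    fencepost≡vv zero = refl
    fencepost≡vv (suc y) = refl

    -- An entry off the occurrence lies in some box, and every row other than i is shaded.
    off-occurrence-in-row-i : ∀ m → m < n → suc m ∉ ps → vvι i < val τ (suc m) × val τ (suc m) < vvι (suc i)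
    off-occurrence-in-row-i m m<n m∉ =
      in-row-i (fencepost-gap 0 (suc n) S v (proj₁ v-range) (s≤s (proj₂ v-range))
                              (off-occurrence-∉O m<n m∉ ∘ ∈-sort⁻ O))
               (fencepost-gap 0 (suc n) ps (suc m) (s≤s z≤n) (s≤s m<n) m∉)
      where
      v = val τ (suc m)
      v-range = All.lookup (proj₂ τ-perm) (nth-∈ 0 t m (<n⇒<length-t m<n))
      in-row-i : ∃[ y ] (y ≤ length S × fencepost 0 (suc n) S y < v × v < fencepost 0 (suc n) S (suc y)) →
                 ∃[ x ] (x ≤ length ps × fencepost 0 (suc n) ps x < suc m × suc m < fencepost 0 (suc n) ps (suc x)) →
                 vvι i < v × v < vvι (suc i)
      in-row-i (y , y≤ , below , above) (x , x≤ , left , right) with y ≟ i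
      ... | yes refl = subst (_< v) (fencepost≡vv y) below , above
      ... | no y≢i = ⊥-elim (proj₂ (proj₂ (proj₂ occ)) x y x≤k y≤k (x≤k , y≤k , y≢i)
                       (suc m , subst (_< suc m) (fencepost≡pos x) left , right ,
                        subst (_< v) (fencepost≡vv y) below , above))
        where
        x≤k = subst (x ≤_) length-ps x≤
        y≤k = subst (y ≤_) length-S y≤

    vv-suc-positive : ∀ y → 1 ≤ vvι (suc y)
    vv-suc-positive y with y <? length S
    ... | yes y< = proj₁ (S-range (nth-∈ (suc n) S y y<))
    ... | no y≮ = subst (1 ≤_) (sym (nth-≥length (suc n) S y (≮⇒≥ y≮))) (s≤s z≤n)

    vv-<-suc : ∀ y → y ≤ k → vvι y < vvι (suc y)
    vv-<-suc zero _ = vv-suc-positive zero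
    vv-<-suc (suc y) y<k with suc y <? length S
    ... | yes y+1< = nth-<-mono (suc n) S-Increasing ≤-refl y+1<
    ... | no y+1≮ = subst (nth (suc n) S (suc y) <_) (sym (nth-≥length (suc n) S (suc y) (≮⇒≥ y+1≮)))
                      (s≤s (proj₂ (S-range (nth-∈ (suc n) S y (subst (y <_) (sym length-S) y<k)))))

    ≤vv : ∀ y → y ≤ k → y ≤ vvι y
    ≤vv zero _ = z≤n
    ≤vv (suc y) y<k = nth-lowerBound (suc n) 0 S-Increasing (All.tabulate (proj₁ ∘ S-range)) y
                        (subst (y <_) (sym length-S) y<k)

    vv-suc-i≤ : vvι (suc i) ≤ suc (i + d)
    vv-suc-i≤ with m≤n⇒m<n∨m≡n i≤k
    ... | inj₂ refl = ≤-reflexive (trans (nth-≥length (suc n) S k (≤-reflexive length-S)) (cong suc (+-comm d k)))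
    ... | inj₁ i<k = +-cancelʳ-≤ r _ _ (begin
      nth (suc n) S (suc i) + r        ≡⟨ cong (λ l → nth (suc n) S (suc i) + (l ∸ suc i)) (sym length-S) ⟩
      nth (suc n) S (suc i) + (length S ∸ suc i)
                                       ≤⟨ nth-upperBound (suc n) n S-Increasing (All.tabulate (proj₂ ∘ S-range)) i
                                            (subst (i <_) (sym length-S) i<k) ⟩
      d + k                            ≡⟨ cong (d +_) (sym (m+[n∸m]≡n i<k)) ⟩
      d + (suc i + r)                  ≡⟨ sym (+-assoc d (suc i) r) ⟩
      d + suc i + r                    ≡⟨ cong (_+ r) (trans (+-suc d i) (cong suc (+-comm d i))) ⟩
      suc (i + d) + r                  ∎)
      where
      open ≤-Reasoning
      r = k ∸ suc i

    private
      ∈O? : Decidable (_∈ O)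
      ∈O? v = any? (v ≟_) O

      ∉O? : Decidable (_∉ O)
      ∉O? v = ¬? (∈O? v)

    length-off-occurrence : length (filter ∉O? t) ≡ d
    length-off-occurrence = +-cancelˡ-≡ k _ _ (begin
      k + length (filter ∉O? t)
        ≡⟨ cong (_+ length (filter ∉O? t)) (sym (trans length-on length-O)) ⟩
      length (filter ∈O? t) + length (filter ∉O? t)
        ≡⟨ length-filter-complementary ∈O? ∉O? (toSum ∘ ∈O?) (λ v∈ v∉ → v∉ v∈) t ⟩
      length t
        ≡⟨ trans length-t (+-comm d k) ⟩
      k + d ∎)
      where
      open ≡-Reasoning
      length-on : length (filter ∈O? t) ≡ length O
      length-on = Unique-⊆⊇⇒length≡ _≟_ (Unique.filter⁺ ∈O? (proj₁ τ-perm)) O-Unique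
        (proj₂ ∘ ∈-filter⁻ ∈O? {xs = t}) (λ v∈ → ∈-filter⁺ ∈O? (O⊆t v∈) v∈)

    gap : ℕ
    gap = vvι (suc i) ∸ suc (vvι i)

    gap-width : suc (vvι i) + gap ≡ vvι (suc i)
    gap-width = m+[n∸m]≡n (vv-<-suc i i≤k)

    off-occurrence⊆gap : filter ∉O? t ⊆ interval (vvι i) gap
    off-occurrence⊆gap v∈ with ∈-filter⁻ ∉O? {xs = t} v∈
    ... | v∈t , v∉O with ∈⇒nth 0 t v∈t
    ... | m , m< , refl with off-occurrence-in-row-i m (subst (m <_) length-t m<) (v∉O ∘ ∈-map⁺ (nth 0 t))
    ... | above , below = ∈-interval⁺ (vvι i) gap above (≤-pred (subst (_ <_) (sym gap-width) below))

    d≤gap : d ≤ gap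
    d≤gap = begin
      d                                  ≡⟨ sym length-off-occurrence ⟩
      length (filter ∉O? t)
        ≤⟨ Unique-⊆⇒length≤ _≟_ (Unique.filter⁺ ∉O? (proj₁ τ-perm)) off-occurrence⊆gap ⟩
      length (interval (vvι i) gap)      ≡⟨ length-interval (vvι i) gap ⟩
      gap                                ∎
      where open ≤-Reasoning

    vv-i+d<vv-suc-i : suc (vvι i + d) ≤ vvι (suc i)
    vv-i+d<vv-suc-i = ≤-trans (s≤s (+-monoʳ-≤ (vvι i) d≤gap)) (≤-reflexive gap-width)

    vv-i≤i : vvι i ≤ i
    vv-i≤i = +-cancelʳ-≤ d _ _ (≤-pred (≤-trans vv-i+d<vv-suc-i vv-suc-i≤))

    i+d<vv-suc-i : i + d < vvι (suc i)
    i+d<vv-suc-i = ≤-trans (s≤s (+-monoˡ-≤ d (≤vv i i≤k))) vv-i+d<vv-suc-i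

    S-Outer : ∀ {z} → z ∈ S → Outer z
    S-Outer z∈ with ∈⇒nth (suc n) S z∈
    ... | a , a< , refl with suc a ≤? i
    ... | yes a<i = inj₁ (≤-trans (below a<i i≤k) vv-i≤i)
      where
      below : ∀ {y} → suc a ≤ y → y ≤ k → nth (suc n) S (suc a) ≤ vvι y
      below {suc y} (s≤s a≤y) y<k = nth-≤-mono (suc n) S-Increasing a≤y (subst (y <_) (sym length-S) y<k)
    ... | no a≮i = inj₂ (≤-trans i+d<vv-suc-i (nth-≤-mono (suc n) S-Increasing (≤-pred (≰⇒> a≮i)) a<))

    O-Outer : ∀ {z} → z ∈ O → Outer z
    O-Outer = S-Outer ∘ ∈-sort⁺ O

    ps≡positions-outer : ps ≡ positions outer? t
    ps≡positions-outer = Increasing-⊆⊇⇒≡ ps-Increasing (positions-Increasing outer? t) ps⊆ ⊆ps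
      where
      ps⊆ : ps ⊆ positions outer? t
      ps⊆ p∈ with ∈ps⇒position p∈
      ... | m , refl , m<n = ∈-positions⁺ outer? t m (<n⇒<length-t m<n) (O-Outer (∈-map⁺ (nth 0 t) p∈))
      ⊆ps : positions outer? t ⊆ ps
      ⊆ps p∈ with ∈-positions⁻ outer? t p∈
      ... | m , refl , m< , outer with any? (suc m ≟_) ps
      ... | yes m∈ = m∈
      ... | no m∉ with off-occurrence-in-row-i m (subst (m <_) length-t m<) m∉
      ... | above , below =
        ⊥-elim (outer⇒¬inner outer (≤-<-trans (≤vv i i≤k) above , ≤-pred (≤-trans below vv-suc-i≤)))

    filter-outer≡O : filter outer? t ≡ O
    filter-outer≡O = trans (sym (map-nth-positions outer? t)) (cong (map (nth 0 t)) (sym ps≡positions-outer))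

    O⊆spreadπ : O ⊆ spreadπ
    O⊆spreadπ {z} z∈ with All.lookup (proj₂ τ-perm) (O⊆t z∈)
    ... | 1≤z , z≤bound = outerValues⊆spreadπ (Outer⇒∈spread-interval i≤k 1≤z z≤bound (O-Outer z∈))

    O≡spreadπ : O ≡ spreadπ
    O≡spreadπ = orderIsomorphic-⊆⊇⇒≡ (trans length-O (sym length-spreadπ)) O-Unique spreadπ-Unique O⊆spreadπ
      (Unique-⊆-length≥⇒⊇ _≟_ O-Unique O⊆spreadπ (≤-reflexive (trans length-spreadπ (sym length-O))))
      order-isomorphic
      where
      <k : ∀ {a} → a < length O → suc a ≤ k
      <k {a} = subst (a <_) length-O
      O-at : ∀ {a} → a < length O → nth 0 O (suc a) ≡ val τ (pos π R τ ι (suc a))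
      O-at {a} a< = nth-map (suc n) 0 (val τ) ps a (subst (a <_) (sym length-ps) (<k a<))
      spreadπ-at : ∀ {a} → a < length O → nth 0 spreadπ (suc a) ≡ spread (nth 0 (toList π) (suc a))
      spreadπ-at {a} a< = nth-map 0 0 spread (toList π) a (subst (a <_) (sym length-π) (<k a<))
      order-isomorphic : ∀ a b → a < length O → b < length O →
        (nth 0 O (suc a) < nth 0 O (suc b)) ⇔ (nth 0 spreadπ (suc a) < nth 0 spreadπ (suc b))
      order-isomorphic a b a< b< rewrite O-at a< | O-at b< | spreadπ-at a< | spreadπ-at b< =
        mk⇔ (spread-<-mono ∘ Equivalence.to iso) (Equivalence.from iso ∘ spread-<-reflect)
        where iso = proj₁ (proj₂ (proj₂ occ)) (suc a) (suc b) (s≤s z≤n) (<k a<) (s≤s z≤n) (<k b<)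

    filter-outer≡spreadπ : filter outer? t ≡ spreadπ
    filter-outer≡spreadπ = trans filter-outer≡O O≡spreadπ

  contains⇔filter-outer : (τ : Vec ℕ n) → IsPerm n τ → Contains π R τ ⇔ (filter outer? (toList τ) ≡ spreadπ)
  contains⇔filter-outer τ τ-perm =
    mk⇔ (λ (ι , occ) → OccurrenceValues.filter-outer≡spreadπ τ τ-perm ι occ) (OuterPositions.contains τ τ-perm)

module Enumeration {k : ℕ} (i d : ℕ) (i≤k : i ≤ k) (π : Vec ℕ k) (π-perm : IsPerm k π) where

  open Window i d
  open Characterisation i d i≤k π π-perm

  toList-spreadπ : toList (Vec.map spread π) ≡ spreadπ
  toList-spreadπ = Vecₚ.toList-map spread π

  open Arrangements i d (Vec.map spread π)
    (subst Unique (sym toList-spreadπ) spreadπ-Unique) (subst (All Outer) (sym toList-spreadπ) spreadπ-Outer)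
    public

  Arrangement⇔containing : ∀ τ → Arrangement d τ ⇔ (IsPerm n τ × Contains π R τ)
  Arrangement⇔containing τ = mk⇔ to from
    where
    to : Arrangement d τ → IsPerm n τ × Contains π R τ
    to (u , adm , outer≡) =
      (u , All.tabulate in-range) ,
      Equivalence.from (contains⇔filter-outer τ (u , All.tabulate in-range)) (trans outer≡ toList-spreadπ)
      where
      in-range : ∀ {v} → v ∈ toList τ → 1 ≤ v × v ≤ n
      in-range {v} v∈ with All.lookup adm v∈
      ... | inj₁ outer = All.lookup spreadπ-range
                           (subst (v ∈_) (trans outer≡ toList-spreadπ) (∈-filter⁺ outer? v∈ outer))
      ... | inj₂ (i<v , v≤i+d) =
        ≤-trans (s≤s z≤n) i<v , ≤-trans v≤i+d (subst (i + d ≤_) (+-comm k d) (+-monoˡ-≤ d i≤k))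
    from : IsPerm n τ × Contains π R τ → Arrangement d τ
    from (τ-perm , contains) =
      proj₁ τ-perm , All.tabulate (λ {v} _ → outer⊎inner v) ,
      trans (Equivalence.to (contains⇔filter-outer τ τ-perm) contains) (sym toList-spreadπ)

  ∈-arrangements⇔containing : ∀ τ → τ ∈ arrangements d ⇔ (IsPerm n τ × Contains π R τ)
  ∈-arrangements⇔containing τ =
    mk⇔ (Equivalence.to (Arrangement⇔containing τ) ∘ arrangements-sound ≤-refl)
        (arrangements-complete ≤-refl τ ∘ Equivalence.from (Arrangement⇔containing τ))

  length-arrangements≡ : length (arrangements d) ≡ n !/ k !
  length-arrangements≡ = begin
    length (arrangements d)                        ≡⟨ sym (m*n/n≡m (length (arrangements d)) (k !) ⦃ k !≢0 ⦄) ⟩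
    (length (arrangements d) * k ! / k !) ⦃ k !≢0 ⦄ ≡⟨ cong (λ m → (m / k !) ⦃ k !≢0 ⦄) (length-arrangements d) ⟩
    n !/ k !                                       ∎
    where open ≡-Reasoning

theorem3p2 : (k : ℕ) → 1 ≤ k → (π : Vec ℕ k) → IsPerm k π →
    (i : ℕ) → i ≤ k → (n : ℕ) → k ≤ n →
    NumContaining n π (allRowsBut k i) (n !/ k !)
theorem3p2 k _ π π-perm i i≤k n k≤n with n ∸ k | m∸n+n≡m k≤n
... | d | refl = arrangements d , arrangements-Unique ≤-refl , ∈-arrangements⇔containing , length-arrangements≡
  where open Enumeration i d i≤k π π-perm
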